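{- Let $F$ be a tract and $\psi$ a Grassmann--Plücker function of rank $r$ on $[n]$ with coefficients in $F$. Define $\varphi:\mathcal{T}_n\cup\mathcal{A}_n\to F$ by $\varphi(B)=\psi(B\cap[n])\cdot\psi^\perp(B^*\cap[n])$ if $|B\cap[n]|=r$ and $\varphi(B)=0$ otherwise. Then $\varphi$ is a restricted Grassmann--Plücker function on $E=[n]\cup[n]^*$ with coefficients in $F$.
   Context: A tract is a pair $F=(G,N_F)$ with $G$ an abelian group (multiplicative) and $N_F\subseteq\mathbb{N}[G]$ such that $0\in N_F$, $1\notin N_F$, there is a unique $\epsilon\in G$ with $1+\epsilon\in N_F$, and $g\sum h_i\in N_F$ whenever $g\in G$, $\sum h_i\in N_F$. Write $F=G\cup\{0\}$, $F^\times=G$, $-1:=\epsilon$. For a linearly ordered set and a subset $S$, $\sigma_S(x)$ is the number of elements of $S$ smaller than $x$. A Grassmann--Plücker function of rank $r$ on $[n]$ with coefficients in $F$ is a not identically zero $\psi:\binom{[n]}{r}\to F$ with $\sum_{x\in S\setminus T}(-1)^{\sigma_S(x)+\sigma_T(x)}\psi(S\setminus\{x\})\psi(T\cup\{x\})\in N_F$ for all $S\in\binom{[n]}{r+1}$, $T\in\binom{[n]}{r-1}$. Its dual $\psi^\perp:\binom{[n]}{n-r}\to F$ is $\psi^\perp([n]\setminus B)=\mathrm{sign}(B)\psi(B)$, where $\mathrm{sign}(B)$ is the sign of the permutation of $[n]$ sending $i$ to the $i$-th smallest element of $B$ for $i\le r$ and to the $(i-r)$-th smallest element of $[n]\setminus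 B$ for $i>r$. $E=[n]\cup[n]^*$ is ordered $1<\dots<n<1^*<\dots<n^*$ with involution $i\leftrightarrow i^*$ and $B^*=\{b^*:b\in B\}$; skew pairs are $\{i,i^*\}$; $\mathcal{T}_n$ ($\mathcal{A}_n$) are the $n$-subsets of $E$ with no (exactly one) skew pair. A restricted Grassmann--Plücker function on $E$ with coefficients in $F$ is a not identically zero $\varphi:\mathcal{T}_n\cup\mathcal{A}_n\to F$ with (Sym) $\varphi(A)=(-1)^{i+j}\varphi((A\setminus\{i,i^*\})\cup\{j,j^*\})$ whenever $A\in\mathcal{A}_n$, $\{i,i^*\}\subseteq A$, $\{j,j^*\}\cap A=\emptyset$; and (rGP) for all $S\subseteq E$ with $|S|=n+1$ containing exactly one skew pair and $T\subseteq E$ with $|T|=n-1$ containing no skew pair, $\sum_{x\in S\setminus T}(-1)^{\sigma_S(x)+\sigma_T(x)}\varphi(S\setminus\{x\})\varphi(T\cup\{x\})\in N_F$. -}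

module Defs where

open import Level using (Level; _⊔_)
open import Data.Nat using (ℕ; zero; suc; _+_; _≡ᵇ_)
open import Data.Bool using (Bool; true; false; if_then_else_; _∧_; not)
open import Data.Fin using (Fin; toℕ; _↑ˡ_; _↑ʳ_; _<?_)
open import Data.Fin.Subset using (Subset; ∣_∣; _∪_; _-_; ⁅_⁆; ∁; _∈_; _∉_)
open import Data.Fin.Subset.Properties using (_∈?_)
open import Data.Vec using (lookup; tabulate)
open import Data.List using (List; []; _∷_; [_]; map; filter; length; catMaybes; _++_)
open import Data.List.Relation.Binary.Permutation.Propositional using (_↭_)
open import Data.Maybe using (Maybe; just; nothing)
open import Data.Product using (Σ; _×_)
open import Data.Sum using (_⊎_)
open import Relation.Nullary using (¬_)
open import Relation.Nullary.Decidable using (⌊_⌋; ¬?)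
open import Relation.Binary.PropositionalEquality using (_≡_; _≢_)

-- An element of ℕ[G] is represented by a finite list of elements of G
-- (the formal sum of its entries); N is required to be invariant under
-- reordering, so that it is really a subset of ℕ[G].

record Tract (a ℓ : Level) : Set (Level.suc (a ⊔ ℓ)) where
  field
    G      : Set a
    _·_    : G → G → G
    e      : G
    _⁻¹    : G → G
    ·-assoc : ∀ x y z → (x · y) · z ≡ x · (y · z)
    ·-comm  : ∀ x y → x · y ≡ y · x
    ·-idˡ   : ∀ x → e · x ≡ x
    ·-invˡ  : ∀ x → (x ⁻¹) · x ≡ e
    N       : List G → Set ℓ
    N-perm  : ∀ {xs ys} → xs ↭ ys → N xs → N ys
    N-zero  : N []
    N-one   : ¬ N [ e ]
    ε       : G
    N-ε     : N (e ∷ ε ∷ [])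
    ε-unique : ∀ g → N (e ∷ g ∷ []) → g ≡ ε
    N-scale : ∀ g xs → N xs → N (map (g ·_) xs)

module _ {a ℓ : Level} (F : Tract a ℓ) where
  open Tract F

  -- F = G ∪ {0}, with 0 represented by nothing
  El : Set a
  El = Maybe G

  _⊗_ : El → El → El
  just x ⊗ just y = just (x · y)
  _ ⊗ _ = nothing

  -- (-1)^k as an element of F, where -1 := ε
  ε^ : ℕ → G
  ε^ zero = e
  ε^ (suc k) = ε · ε^ k

  sgn : ℕ → El
  sgn k = just (ε^ k)

  σ : ∀ {m} → Subset m → Fin m → ℕ
  σ S x = ∣ tabulate (λ y → lookup S y ∧ ⌊ y <? x ⌋) ∣

  -- the formal sum  Σ_{x ∈ S \ T} (-1)^{σ_S(x)+σ_T(x)} f(S\{x}) f(T∪{x})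
  -- as an element of ℕ[G] (zero terms dropped)
  gpSum : ∀ {m} → (Subset m → El) → Subset m → Subset m → List G
  gpSum {m} f S T = catMaybes (map term (Data.List.allFin m))
    where
    term : Fin m → El
    term x = if lookup S x ∧ not (lookup T x)
             then sgn (σ S x + σ T x) ⊗ (f (S - x) ⊗ f (T ∪ ⁅ x ⁆))
             else nothing

  -- Grassmann–Plücker function of rank r on [n] (ψ given on all subsets;
  -- only its values on r-subsets are ever used)
  record IsGP (n r : ℕ) (ψ : Subset n → El) : Set (a ⊔ ℓ) where
    field
      nonzero : Σ (Subset n) λ B → ∣ B ∣ ≡ r × ψ B ≢ nothing
      gp : ∀ (S T : Subset n) → ∣ S ∣ ≡ suc r → suc ∣ T ∣ ≡ r →
           N (gpSum ψ S T)

  -- sign(B): sign of the permutation i ↦ i-th smallest element of B (i ≤ r),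
  -- then the elements of [n]\B in increasing order; computed as (-1)^(number of
  -- inversions) of its one-line notation.
  oneLine : ∀ {n} → Subset n → List (Fin n)
  oneLine {n} B = filter (_∈? B) (Data.List.allFin n)
               ++ filter (λ x → ¬? (x ∈? B)) (Data.List.allFin n)

  inversions : ∀ {n} → List (Fin n) → ℕ
  inversions [] = 0
  inversions (x ∷ xs) = length (filter (_<? x) xs) + inversions xs

  sign : ∀ {n} → Subset n → El
  sign B = sgn (inversions (oneLine B))

  dual : ∀ {n} → (Subset n → El) → Subset n → El
  dual ψ C = sign (∁ C) ⊗ ψ (∁ C)

  -- E = [n] ∪ [n]^* as Fin (n + n): i ↦ i, i^* ↦ n + i
  emb : ∀ n → Fin n → Fin (n + n)
  emb n i = i ↑ˡ n

  star : ∀ n → Fin n → Fin (n + n)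
  star n i = n ↑ʳ i

  unstarred : ∀ n → Subset (n + n) → Subset n
  unstarred n B = tabulate (λ i → lookup B (emb n i))

  starred : ∀ n → Subset (n + n) → Subset n
  starred n B = tabulate (λ i → lookup B (star n i))

  skew : ∀ n → Subset (n + n) → ℕ
  skew n B = ∣ tabulate (λ i → lookup B (emb n i) ∧ lookup B (star n i)) ∣

  phi : (n r : ℕ) → (Subset n → El) → Subset (n + n) → El
  phi n r ψ B = if ∣ unstarred n B ∣ ≡ᵇ r
                then ψ (unstarred n B) ⊗ dual ψ (starred n B)
                else nothing

  -- restricted Grassmann–Plücker function on E (φ given on all subsets of E;
  -- only its values on T_n ∪ A_n are ever used)
  record IsRGP (n : ℕ) (φ : Subset (n + n) → El) : Set (a ⊔ ℓ) where
    field
      nonzero : Σ (Subset (n + n)) λ A →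
                ∣ A ∣ ≡ n × (skew n A ≡ 0 ⊎ skew n A ≡ 1) × φ A ≢ nothing
      sym : ∀ (A : Subset (n + n)) (i j : Fin n) →
            ∣ A ∣ ≡ n → skew n A ≡ 1 →
            emb n i ∈ A → star n i ∈ A → emb n j ∉ A → star n j ∉ A →
            φ A ≡ sgn (toℕ i + toℕ j)
                    ⊗ φ ((((A - emb n i) - star n i) ∪ ⁅ emb n j ⁆) ∪ ⁅ star n j ⁆)
      rgp : ∀ (S T : Subset (n + n)) →
            ∣ S ∣ ≡ suc n → skew n S ≡ 1 → suc ∣ T ∣ ≡ n → skew n T ≡ 0 →
            N (gpSum φ S T)

{-# OPTIONS --safe #-}
-- Write a subset of E as U ++ V with U = B ∩ [n] and V = B* ∩ [n], so that φ (U ++ V) is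
-- ψ(U) ψ^⊥(V) when |U| = r and 0 otherwise.
--
-- (rGP) Let S = U ++ V and T = U′ ++ V′. The terms of the sum with x ∈ [n] are ψ^⊥(V) ψ^⊥(V′)
-- times those of ψ's GP sum for (U, U′), and vanish unless |U| = r + 1 and |U′| = r - 1; the
-- terms with x ∈ [n]* are ± ψ(U) ψ(U′) times those of ψ^⊥'s GP sum for (V, V′), and vanish unless
-- |U| = |U′| = r. So at most one half survives, and it lies in N because ψ^⊥ is again a GP
-- function: term by term, its GP sum for (S, T) is ψ's GP sum for (∁T, ∁S) times a fixed sign.
-- Only the sizes of S and T matter, not their skew pairs.
--
-- (Sym) If A = U ++ V contains the skew pair {i, i*} and misses {j, j*}, then counting shows
-- ∁V = (U - i) ∪ {j} and ∁((V - i) ∪ {j}) = U, and sign (X ∪ {y}) = (-1)^(y + |X|) sign X turns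
-- the exchange of i for j into the factor (-1)^(i + j).
module Submission where

open import Defs hiding (_⊗_)
import Defs
open import Level using (Level)
open import Algebra.Bundles using (CommutativeMonoid)
open import Algebra.Structures.Biased using (isCommutativeMonoidˡ)
import Algebra.Solver.CommutativeMonoid as CommutativeMonoidSolver
open import Data.Nat using (ℕ; zero; suc; _+_; _≤_; s≤s; _≟_)
open import Data.Nat.Properties
  using (m∸n+n≡m; <-irrefl; ≤-trans; ≤-reflexive; +-cancelʳ-≡; +-comm; +-suc; +-assoc; +-identityʳ;
         suc-injective; 1+n≢n)
open import Data.Nat.Tactic.RingSolver using (solve-∀)
open import Data.Bool using (Bool; true; false; not; _∧_; if_then_else_)
open import Data.Bool.Properties using (∨-identityʳ; ∨-zeroʳ; ∧-zeroʳ; not-involutive)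
open import Data.Fin as Fin using (Fin; zero; suc; toℕ; _↑ˡ_; _↑ʳ_; _<?_)
open import Data.Fin.Subset
  using (Subset; inside; outside; ∣_∣; _∪_; _∩_; _─_; _-_; ⁅_⁆; ∁; _∈_; _∉_; _⊆_)
open import Data.Fin.Subset.Properties
  using (_∈?_; p─⊥≡p; ∪-identityʳ; drop-not-there; drop-∷-⊆; p⊆q⇒∣p∣≤∣q∣; ∣∁p∣≡n∸∣p∣; ∣p∣≤n; ∣⊥∣≡0;
         x∈p⇒x∉∁p; x∉p⇒x∈∁p; p─q⊆p; x∈p∪q⁻; x∈p∩q⁺; x∈⁅y⁆⇒x≡y; ∣⁅x⁆∣≡1; ∩-inverseʳ)
open import Data.Vec using ([]; _∷_; _++_; lookup; tabulate; here; there)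
open import Data.Vec.Properties
  using (map-∘; map-cong; map-id; tabulate-cong; tabulate∘lookup; lookup∘tabulate; lookup-map;
         lookup-zipWith; lookup-++ˡ; lookup-++ʳ; lookup⇒[]=; []=⇒lookup)
open import Data.List as List using (List; []; _∷_; length; filter; map; allFin; catMaybes)
import Data.List.Properties as List
open import Data.List.Relation.Binary.Permutation.Propositional using (swap; ↭-refl)
open import Data.Maybe using (just; nothing)
open import Data.Product using (Σ; _×_; _,_)
open import Data.Sum using (_⊎_; inj₁; inj₂)
open import Function using (id; _∘_; flip)
open import Relation.Nullary using (¬_; Dec; yes; no; does; ¬?; contradiction)
open import Relation.Nullary.Decidable using (_×-dec_; ⌊_⌋; isYes≗does; dec-true; dec-false)
open import Relation.Binary.PropositionalEquality

private variable
  m k n : ℕ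

-- Subsets

x∈p⇒suc∣p-x∣≡∣p∣ : ∀ {x : Fin n} {p} → x ∈ p → suc ∣ p - x ∣ ≡ ∣ p ∣
x∈p⇒suc∣p-x∣≡∣p∣ {p = inside ∷ p}  here        = cong (λ q → suc ∣ q ∣) (p─⊥≡p p)
x∈p⇒suc∣p-x∣≡∣p∣ {p = inside ∷ p}  (there x∈p) = cong suc (x∈p⇒suc∣p-x∣≡∣p∣ x∈p)
x∈p⇒suc∣p-x∣≡∣p∣ {p = outside ∷ p} (there x∈p) = x∈p⇒suc∣p-x∣≡∣p∣ x∈p

x∉p⇒∣p∪⁅x⁆∣≡suc∣p∣ : ∀ {x : Fin n} {p} → x ∉ p → ∣ p ∪ ⁅ x ⁆ ∣ ≡ suc ∣ p ∣
x∉p⇒∣p∪⁅x⁆∣≡suc∣p∣ {x = zero}  {outside ∷ p} _   = cong (λ q → suc ∣ q ∣) (∪-identityʳ p)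
x∉p⇒∣p∪⁅x⁆∣≡suc∣p∣ {x = zero}  {inside ∷ p}  x∉p = contradiction here x∉p
x∉p⇒∣p∪⁅x⁆∣≡suc∣p∣ {x = suc x} {inside ∷ p}  x∉p = cong suc (x∉p⇒∣p∪⁅x⁆∣≡suc∣p∣ (drop-not-there x∉p))
x∉p⇒∣p∪⁅x⁆∣≡suc∣p∣ {x = suc x} {outside ∷ p} x∉p = x∉p⇒∣p∪⁅x⁆∣≡suc∣p∣ (drop-not-there x∉p)

∣∁p∣+∣p∣≡n : ∀ (p : Subset n) → ∣ ∁ p ∣ + ∣ p ∣ ≡ n
∣∁p∣+∣p∣≡n p = trans (cong (_+ ∣ p ∣) (∣∁p∣≡n∸∣p∣ p)) (m∸n+n≡m (∣p∣≤n p))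

∣p++q∣≡∣p∣+∣q∣ : ∀ (p : Subset m) (q : Subset k) → ∣ p ++ q ∣ ≡ ∣ p ∣ + ∣ q ∣
∣p++q∣≡∣p∣+∣q∣ []            q = refl
∣p++q∣≡∣p∣+∣q∣ (inside ∷ p)  q = cong suc (∣p++q∣≡∣p∣+∣q∣ p q)
∣p++q∣≡∣p∣+∣q∣ (outside ∷ p) q = ∣p++q∣≡∣p∣+∣q∣ p q

all-false⇒∣tabulate∣≡0 : ∀ (f : Fin n → Bool) → (∀ y → f y ≡ false) → ∣ tabulate f ∣ ≡ 0
all-false⇒∣tabulate∣≡0 {zero}  f _ = refl
all-false⇒∣tabulate∣≡0 {suc n} f f≡false rewrite f≡false zero =
  all-false⇒∣tabulate∣≡0 (f ∘ suc) (f≡false ∘ suc)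

lookup≡false⇒∉ : ∀ {p : Subset n} {x} → lookup p x ≡ false → x ∉ p
lookup≡false⇒∉ p[x]≡false x∈p with () ← trans (sym ([]=⇒lookup x∈p)) p[x]≡false

∁-involutive : ∀ (p : Subset n) → ∁ (∁ p) ≡ p
∁-involutive p = trans (sym (map-∘ not not p)) (trans (map-cong not-involutive p) (map-id p))

∁-─ : ∀ (p q : Subset n) → ∁ (p ─ q) ≡ ∁ p ∪ q
∁-─ []      []            = refl
∁-─ (x ∷ p) (inside ∷ q)  = cong₂ _∷_ (sym (∨-zeroʳ (not x))) (∁-─ p q)
∁-─ (x ∷ p) (outside ∷ q) = cong₂ _∷_ (sym (∨-identityʳ (not x))) (∁-─ p q)

∁-∪ : ∀ (p q : Subset n) → ∁ (p ∪ q) ≡ ∁ p ─ q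
∁-∪ []      []            = refl
∁-∪ (x ∷ p) (inside ∷ q)  = cong₂ _∷_ (cong not (∨-zeroʳ x)) (∁-∪ p q)
∁-∪ (x ∷ p) (outside ∷ q) = cong₂ _∷_ (cong not (∨-identityʳ x)) (∁-∪ p q)

x∈p⇒p-x∪⁅x⁆≡p : ∀ {x : Fin n} {p} → x ∈ p → (p - x) ∪ ⁅ x ⁆ ≡ p
x∈p⇒p-x∪⁅x⁆≡p {p = inside ∷ p} here        = cong (inside ∷_) (trans (∪-identityʳ _) (p─⊥≡p p))
x∈p⇒p-x∪⁅x⁆≡p {p = s ∷ p}      (there x∈p) = cong₂ _∷_ (∨-identityʳ s) (x∈p⇒p-x∪⁅x⁆≡p x∈p)

x∉p-x : ∀ {x : Fin n} p → x ∉ p - x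
x∉p-x {x = suc x} (s ∷ p) (there x∈p-x) = x∉p-x p x∈p-x

p⊆q⇒∣q∣≤∣p∣⇒p≡q : ∀ {p q : Subset n} → p ⊆ q → ∣ q ∣ ≤ ∣ p ∣ → p ≡ q
p⊆q⇒∣q∣≤∣p∣⇒p≡q {p = []}          {[]}          _   _           = refl
p⊆q⇒∣q∣≤∣p∣⇒p≡q {p = inside ∷ p}  {inside ∷ q}  p⊆q (s≤s q≤p) =
  cong (inside ∷_) (p⊆q⇒∣q∣≤∣p∣⇒p≡q (drop-∷-⊆ p⊆q) q≤p)
p⊆q⇒∣q∣≤∣p∣⇒p≡q {p = outside ∷ p} {outside ∷ q} p⊆q q≤p       =
  cong (outside ∷_) (p⊆q⇒∣q∣≤∣p∣⇒p≡q (drop-∷-⊆ p⊆q) q≤p)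
p⊆q⇒∣q∣≤∣p∣⇒p≡q {p = inside ∷ p}  {outside ∷ q} p⊆q _ with () ← p⊆q here
p⊆q⇒∣q∣≤∣p∣⇒p≡q {p = outside ∷ p} {inside ∷ q}  p⊆q q<p       =
  contradiction (≤-trans q<p (p⊆q⇒∣p∣≤∣q∣ (drop-∷-⊆ p⊆q))) (<-irrefl refl)

∣p∣≡1⇒x∈p⇒y∈p⇒y≡x : ∀ {p : Subset n} {x y} → ∣ p ∣ ≡ 1 → x ∈ p → y ∈ p → y ≡ x
∣p∣≡1⇒x∈p⇒y∈p⇒y≡x {p = p} {x} ∣p∣≡1 x∈p y∈p = x∈⁅y⁆⇒x≡y x (subst (_ ∈_) (sym ⁅x⁆≡p) y∈p)
  where
  ⁅x⁆≡p : ⁅ x ⁆ ≡ p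
  ⁅x⁆≡p = p⊆q⇒∣q∣≤∣p∣⇒p≡q (λ y∈⁅x⁆ → subst (_∈ p) (sym (x∈⁅y⁆⇒x≡y x y∈⁅x⁆)) x∈p)
                          (≤-reflexive (trans ∣p∣≡1 (sym (∣⁅x⁆∣≡1 x))))

p-i∪⁅j⁆≡∁q : ∀ {p q : Subset n} {i j} → ∣ p ∣ + ∣ q ∣ ≡ n → (∀ {x} → x ∈ p → x ∈ q → x ≡ i) →
             i ∈ p → j ∉ p → j ∉ q → (p - i) ∪ ⁅ j ⁆ ≡ ∁ q
p-i∪⁅j⁆≡∁q {p = p} {q} {i} {j} ∣p∣+∣q∣≡n p∩q⊆⁅i⁆ i∈p j∉p j∉q =
  p⊆q⇒∣q∣≤∣p∣⇒p≡q ⊆∁q (≤-reflexive ∣∁q∣≡∣p-i∪⁅j⁆∣)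
  where
  open ≡-Reasoning
  ⊆∁q : (p - i) ∪ ⁅ j ⁆ ⊆ ∁ q
  ⊆∁q x∈ with x∈p∪q⁻ (p - i) ⁅ j ⁆ x∈
  ... | inj₁ x∈p-i = x∉p⇒x∈∁p λ x∈q →
          x∉p-x p (subst (_∈ p - i) (p∩q⊆⁅i⁆ (p─q⊆p p ⁅ i ⁆ x∈p-i) x∈q) x∈p-i)
  ... | inj₂ x∈⁅j⁆ = x∉p⇒x∈∁p (subst (_∉ q) (sym (x∈⁅y⁆⇒x≡y j x∈⁅j⁆)) j∉q)
  ∣∁q∣≡∣p-i∪⁅j⁆∣ : ∣ ∁ q ∣ ≡ ∣ (p - i) ∪ ⁅ j ⁆ ∣
  ∣∁q∣≡∣p-i∪⁅j⁆∣ = begin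
    ∣ ∁ q ∣             ≡⟨ +-cancelʳ-≡ (∣ q ∣) (∣ ∁ q ∣) (∣ p ∣) (trans (∣∁p∣+∣p∣≡n q) (sym ∣p∣+∣q∣≡n)) ⟩
    ∣ p ∣               ≡⟨ sym (x∈p⇒suc∣p-x∣≡∣p∣ i∈p) ⟩
    suc ∣ p - i ∣       ≡⟨ sym (x∉p⇒∣p∪⁅x⁆∣≡suc∣p∣ (j∉p ∘ p─q⊆p p ⁅ i ⁆)) ⟩
    ∣ (p - i) ∪ ⁅ j ⁆ ∣ ∎

tabulate∘lookup-++ : ∀ (S : Subset (m + k)) → tabulate (lookup S ∘ (_↑ˡ k)) ++ tabulate (lookup S ∘ (m ↑ʳ_)) ≡ S
tabulate∘lookup-++ {zero}  S       = tabulate∘lookup S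
tabulate∘lookup-++ {suc m} (s ∷ S) = cong (s ∷_) (tabulate∘lookup-++ {m} S)

tabulate-++ : ∀ {b} {A : Set b} (t : Fin (m + k) → A) →
              List.tabulate t ≡ List.tabulate (t ∘ (_↑ˡ k)) List.++ List.tabulate (t ∘ (m ↑ʳ_))
tabulate-++ {zero}  t = refl
tabulate-++ {suc m} t = cong (t zero ∷_) (tabulate-++ {m} (t ∘ suc))

∈-++⁺ˡ : ∀ {p : Subset m} {q : Subset k} {i} → i ∈ p → i ↑ˡ k ∈ p ++ q
∈-++⁺ˡ here        = here
∈-++⁺ˡ (there i∈p) = there (∈-++⁺ˡ i∈p)

∈-++⁻ˡ : ∀ {p : Subset m} {q : Subset k} i → i ↑ˡ k ∈ p ++ q → i ∈ p
∈-++⁻ˡ {p = _ ∷ _} zero    here      = here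
∈-++⁻ˡ {p = _ ∷ _} (suc i) (there h) = there (∈-++⁻ˡ i h)

∈-++⁺ʳ : ∀ (p : Subset m) {q : Subset k} {j} → j ∈ q → m ↑ʳ j ∈ p ++ q
∈-++⁺ʳ []      j∈q = j∈q
∈-++⁺ʳ (_ ∷ p) j∈q = there (∈-++⁺ʳ p j∈q)

∈-++⁻ʳ : ∀ (p : Subset m) {q : Subset k} {j} → m ↑ʳ j ∈ p ++ q → j ∈ q
∈-++⁻ʳ []      h         = h
∈-++⁻ʳ (_ ∷ p) (there h) = ∈-++⁻ʳ p h

++-remove-↑ˡ : ∀ (p : Subset m) (q : Subset k) i → (p ++ q) - (i ↑ˡ k) ≡ (p - i) ++ q
++-remove-↑ˡ (x ∷ p) q zero    = cong (outside ∷_) (trans (p─⊥≡p (p ++ q)) (cong (_++ q) (sym (p─⊥≡p p))))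
++-remove-↑ˡ (x ∷ p) q (suc i) = cong (x ∷_) (++-remove-↑ˡ p q i)

++-remove-↑ʳ : ∀ (p : Subset m) (q : Subset k) j → (p ++ q) - (m ↑ʳ j) ≡ p ++ (q - j)
++-remove-↑ʳ []      q j = refl
++-remove-↑ʳ (x ∷ p) q j = cong (x ∷_) (++-remove-↑ʳ p q j)

++-insert-↑ˡ : ∀ (p : Subset m) (q : Subset k) i → (p ++ q) ∪ ⁅ i ↑ˡ k ⁆ ≡ (p ∪ ⁅ i ⁆) ++ q
++-insert-↑ˡ (x ∷ p) q zero    = cong (_ ∷_) (trans (∪-identityʳ (p ++ q)) (cong (_++ q) (sym (∪-identityʳ p))))
++-insert-↑ˡ (x ∷ p) q (suc i) = cong (_ ∷_) (++-insert-↑ˡ p q i)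

++-insert-↑ʳ : ∀ (p : Subset m) (q : Subset k) j → (p ++ q) ∪ ⁅ m ↑ʳ j ⁆ ≡ p ++ (q ∪ ⁅ j ⁆)
++-insert-↑ʳ []      q j = refl
++-insert-↑ʳ (x ∷ p) q j = cong₂ _∷_ (∨-identityʳ x) (++-insert-↑ʳ p q j)

++-exchange : ∀ (p q : Subset n) i j →
              ((((p ++ q) - (i ↑ˡ n)) - (n ↑ʳ i)) ∪ ⁅ j ↑ˡ n ⁆) ∪ ⁅ n ↑ʳ j ⁆
              ≡ ((p - i) ∪ ⁅ j ⁆) ++ ((q - i) ∪ ⁅ j ⁆)
++-exchange p q i j
  rewrite ++-remove-↑ˡ p q i | ++-remove-↑ʳ (p - i) q i
        | ++-insert-↑ˡ (p - i) (q - i) j | ++-insert-↑ʳ ((p - i) ∪ ⁅ j ⁆) (q - i) j = refl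

-- Inversion counts

-- the number of pairs x < y with x ∉ B and y ∈ B, i.e. of inversions of oneLine B
inversionCount : Subset n → ℕ
inversionCount []            = 0
inversionCount (inside ∷ B)  = inversionCount B
inversionCount (outside ∷ B) = ∣ B ∣ + inversionCount B

inversionCount-∪⁅⁆ : ∀ {y : Fin n} {X} → y ∉ X → inversionCount (X ∪ ⁅ y ⁆) + ∣ X ∣ ≡ inversionCount X + toℕ y
inversionCount-∪⁅⁆ {y = zero}  {outside ∷ X} _ rewrite ∪-identityʳ X =
  trans (+-comm (inversionCount X) ∣ X ∣) (sym (+-identityʳ _))
inversionCount-∪⁅⁆ {y = zero}  {inside ∷ X}  y∉X = contradiction here y∉X
inversionCount-∪⁅⁆ {y = suc y} {inside ∷ X}  y∉X =
  trans (+-suc _ _) (trans (cong suc (inversionCount-∪⁅⁆ (drop-not-there y∉X))) (sym (+-suc _ _)))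
inversionCount-∪⁅⁆ {y = suc y} {outside ∷ X} y∉X = begin
  (∣ X ∪ ⁅ y ⁆ ∣ + inversionCount (X ∪ ⁅ y ⁆)) + ∣ X ∣ ≡⟨ +-assoc ∣ X ∪ ⁅ y ⁆ ∣ _ _ ⟩
  ∣ X ∪ ⁅ y ⁆ ∣ + (inversionCount (X ∪ ⁅ y ⁆) + ∣ X ∣) ≡⟨ cong₂ _+_ (x∉p⇒∣p∪⁅x⁆∣≡suc∣p∣ y∉X′)
                                                                  (inversionCount-∪⁅⁆ y∉X′) ⟩
  suc ∣ X ∣ + (inversionCount X + toℕ y)               ≡⟨ rearrange ∣ X ∣ (inversionCount X) (toℕ y) ⟩
  (∣ X ∣ + inversionCount X) + suc (toℕ y)             ∎
  where
  open ≡-Reasoning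
  y∉X′ = drop-not-there y∉X
  rearrange : ∀ a b c → suc a + (b + c) ≡ (a + b) + suc c
  rearrange = solve-∀

members nonMembers : Subset n → List (Fin n)
members    B = filter (_∈? B) (allFin _)
nonMembers B = filter (λ x → ¬? (x ∈? B)) (allFin _)

tabulate-suc : ∀ n → List.tabulate {n = n} Fin.suc ≡ map Fin.suc (allFin n)
tabulate-suc n = sym (List.map-tabulate id Fin.suc)

filter-∈?-map-suc : ∀ s (B : Subset n) L → filter (_∈? (s ∷ B)) (map suc L) ≡ map suc (filter (_∈? B) L)
filter-∈?-map-suc s B []      = refl
filter-∈?-map-suc s B (x ∷ L) with does (x ∈? B)
... | true  = cong (suc x ∷_) (filter-∈?-map-suc s B L)
... | false = filter-∈?-map-suc s B L

filter-∉?-map-suc : ∀ s (B : Subset n) L →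
                    filter (λ x → ¬? (x ∈? (s ∷ B))) (map suc L) ≡ map suc (filter (λ x → ¬? (x ∈? B)) L)
filter-∉?-map-suc s B []      = refl
filter-∉?-map-suc s B (x ∷ L) with does (x ∈? B)
... | true  = filter-∉?-map-suc s B L
... | false = cong (suc x ∷_) (filter-∉?-map-suc s B L)

members-inside : ∀ (B : Subset n) → members (inside ∷ B) ≡ zero ∷ map suc (members B)
members-inside B = cong (zero ∷_) (trans (cong (filter (_∈? (inside ∷ B))) (tabulate-suc _))
                                         (filter-∈?-map-suc inside B (allFin _)))

members-outside : ∀ (B : Subset n) → members (outside ∷ B) ≡ map suc (members B)
members-outside B = trans (cong (filter (_∈? (outside ∷ B))) (tabulate-suc _))
                          (filter-∈?-map-suc outside B (allFin _))

nonMembers-inside : ∀ (B : Subset n) → nonMembers (inside ∷ B) ≡ map suc (nonMembers B)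
nonMembers-inside B = trans (cong (filter (λ x → ¬? (x ∈? (inside ∷ B)))) (tabulate-suc _))
                            (filter-∉?-map-suc inside B (allFin _))

nonMembers-outside : ∀ (B : Subset n) → nonMembers (outside ∷ B) ≡ zero ∷ map suc (nonMembers B)
nonMembers-outside B = cong (zero ∷_) (trans (cong (filter (λ x → ¬? (x ∈? (outside ∷ B)))) (tabulate-suc _))
                                             (filter-∉?-map-suc outside B (allFin _)))

length-members : ∀ (B : Subset n) → length (members B) ≡ ∣ B ∣
length-members []            = refl
length-members (inside ∷ B)  =
  trans (cong length (members-inside B)) (cong suc (trans (List.length-map Fin.suc (members B)) (length-members B)))
length-members (outside ∷ B) =
  trans (cong length (members-outside B)) (trans (List.length-map Fin.suc (members B)) (length-members B))

module _ {a ℓ : Level} (F : Tract a ℓ) where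
  open Tract F

  -- Arithmetic in F = G ∪ {0}

  infixr 7 _⊗_
  _⊗_ : El F → El F → El F
  _⊗_ = Defs._⊗_ F

  ·-identityʳ : ∀ x → x · e ≡ x
  ·-identityʳ x = trans (·-comm x e) (·-idˡ x)

  -- multiplying 1 + ε ∈ N by ε⁻¹ gives ε⁻¹ + 1 ∈ N, so ε⁻¹ = ε by uniqueness of ε
  ε·ε≡e : ε · ε ≡ e
  ε·ε≡e = trans (cong (_· ε) (sym ε⁻¹≡ε)) (·-invˡ ε)
    where
    ε⁻¹≡ε : ε ⁻¹ ≡ ε
    ε⁻¹≡ε = ε-unique (ε ⁻¹) (N-perm (swap _ _ ↭-refl)
              (subst N (cong₂ (λ x y → x ∷ y ∷ []) (·-identityʳ (ε ⁻¹)) (·-invˡ ε)) (N-scale (ε ⁻¹) _ N-ε)))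

  ⊗-assoc : ∀ x y z → (x ⊗ y) ⊗ z ≡ x ⊗ (y ⊗ z)
  ⊗-assoc (just x) (just y) (just z) = cong just (·-assoc x y z)
  ⊗-assoc (just x) (just y) nothing  = refl
  ⊗-assoc (just x) nothing  z        = refl
  ⊗-assoc nothing  y        z        = refl

  ⊗-comm : ∀ x y → x ⊗ y ≡ y ⊗ x
  ⊗-comm (just x) (just y) = cong just (·-comm x y)
  ⊗-comm (just x) nothing  = refl
  ⊗-comm nothing  (just y) = refl
  ⊗-comm nothing  nothing  = refl

  ⊗-identityˡ : ∀ x → just e ⊗ x ≡ x
  ⊗-identityˡ (just x) = cong just (·-idˡ x)
  ⊗-identityˡ nothing  = refl

  ⊗-zeroʳ : ∀ x → x ⊗ nothing ≡ nothing
  ⊗-zeroʳ (just x) = refl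
  ⊗-zeroʳ nothing  = refl

  ⊗-nonzero : ∀ {x y} → x ≢ nothing → y ≢ nothing → x ⊗ y ≢ nothing
  ⊗-nonzero {just x}  {just y}  _   _   ()
  ⊗-nonzero {just x}  {nothing} _   y≢0 = contradiction refl y≢0
  ⊗-nonzero {nothing}           x≢0 _   = contradiction refl x≢0

  ⊗-commutativeMonoid : CommutativeMonoid a a
  ⊗-commutativeMonoid = record
    { isCommutativeMonoid = isCommutativeMonoidˡ record
      { isSemigroup = record
        { isMagma = record { isEquivalence = isEquivalence ; ∙-cong = cong₂ _⊗_ }
        ; assoc   = ⊗-assoc
        }
      ; identityˡ = ⊗-identityˡ
      ; comm      = ⊗-comm
      }
    }

  open CommutativeMonoidSolver ⊗-commutativeMonoid using (solve; _⊜_; _⊕_)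

  sgn-+ : ∀ i j → sgn F (i + j) ≡ sgn F i ⊗ sgn F j
  sgn-+ zero    j = sym (⊗-identityˡ (sgn F j))
  sgn-+ (suc i) j = trans (cong (just ε ⊗_) (sgn-+ i j)) (sym (⊗-assoc (just ε) (sgn F i) (sgn F j)))

  sgn-square : ∀ i → sgn F i ⊗ sgn F i ≡ just e
  sgn-square zero    = cong just (·-idˡ e)
  sgn-square (suc i) = begin
    (just ε ⊗ sgn F i) ⊗ (just ε ⊗ sgn F i)
      ≡⟨ solve 2 (λ x y → (x ⊕ y) ⊕ (x ⊕ y) ⊜ (x ⊕ x) ⊕ (y ⊕ y)) refl (just ε) (sgn F i) ⟩
    just (ε · ε) ⊗ (sgn F i ⊗ sgn F i)
      ≡⟨ cong₂ _⊗_ (cong just ε·ε≡e) (sgn-square i) ⟩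
    just (e · e)
      ≡⟨ cong just (·-idˡ e) ⟩
    just e ∎
    where open ≡-Reasoning

  sgn-even-sum : ∀ i j k → i + j ≡ k + k → sgn F i ≡ sgn F j
  sgn-even-sum i j k i+j≡k+k = begin
    sgn F i                        ≡⟨ sym (trans (⊗-comm (sgn F i) (just e)) (⊗-identityˡ (sgn F i))) ⟩
    sgn F i ⊗ just e               ≡⟨ cong (sgn F i ⊗_) (sym (sgn-square j)) ⟩
    sgn F i ⊗ (sgn F j ⊗ sgn F j)  ≡⟨ sym (⊗-assoc (sgn F i) (sgn F j) (sgn F j)) ⟩
    (sgn F i ⊗ sgn F j) ⊗ sgn F j  ≡⟨ cong (_⊗ sgn F j) (sym (sgn-+ i j)) ⟩
    sgn F (i + j) ⊗ sgn F j        ≡⟨ cong (λ t → sgn F t ⊗ sgn F j) i+j≡k+k ⟩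
    sgn F (k + k) ⊗ sgn F j        ≡⟨ cong (_⊗ sgn F j) (trans (sgn-+ k k) (sgn-square k)) ⟩
    just e ⊗ sgn F j               ≡⟨ ⊗-identityˡ (sgn F j) ⟩
    sgn F j                        ∎
    where open ≡-Reasoning

  -- Signs

  ⌊suc<?suc⌋ : ∀ (x y : Fin n) → ⌊ suc y <? suc x ⌋ ≡ ⌊ y <? x ⌋
  ⌊suc<?suc⌋ x y = trans (isYes≗does _) (sym (isYes≗does _))

  σ-zero : ∀ (S : Subset (suc n)) → σ F S zero ≡ 0
  σ-zero S = all-false⇒∣tabulate∣≡0 _ (λ y → ∧-zeroʳ (lookup S y))

  σ-inside : ∀ (S : Subset n) x → σ F (inside ∷ S) (suc x) ≡ suc (σ F S x)
  σ-inside S x = cong (λ v → suc ∣ v ∣) (tabulate-cong (λ y → cong (lookup S y ∧_) (⌊suc<?suc⌋ x y)))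

  σ-outside : ∀ (S : Subset n) x → σ F (outside ∷ S) (suc x) ≡ σ F S x
  σ-outside S x = cong ∣_∣ (tabulate-cong (λ y → cong (lookup S y ∧_) (⌊suc<?suc⌋ x y)))

  σ-↑ˡ : ∀ (p : Subset m) (q : Subset k) i → σ F (p ++ q) (i ↑ˡ k) ≡ σ F p i
  σ-↑ˡ (s ∷ p)       q zero    = trans (σ-zero (s ∷ p ++ q)) (sym (σ-zero (s ∷ p)))
  σ-↑ˡ (inside ∷ p)  q (suc i) = trans (σ-inside (p ++ q) _) (trans (cong suc (σ-↑ˡ p q i)) (sym (σ-inside p i)))
  σ-↑ˡ (outside ∷ p) q (suc i) = trans (σ-outside (p ++ q) _) (trans (σ-↑ˡ p q i) (sym (σ-outside p i)))

  σ-↑ʳ : ∀ (p : Subset m) (q : Subset k) j → σ F (p ++ q) (m ↑ʳ j) ≡ ∣ p ∣ + σ F q j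
  σ-↑ʳ []            q j = refl
  σ-↑ʳ (inside ∷ p)  q j = trans (σ-inside (p ++ q) _) (cong suc (σ-↑ʳ p q j))
  σ-↑ʳ (outside ∷ p) q j = trans (σ-outside (p ++ q) _) (σ-↑ʳ p q j)

  σ+σ∁≡toℕ : ∀ (S : Subset n) x → σ F S x + σ F (∁ S) x ≡ toℕ x
  σ+σ∁≡toℕ (s ∷ S)       zero    = cong₂ _+_ (σ-zero (s ∷ S)) (σ-zero (∁ (s ∷ S)))
  σ+σ∁≡toℕ (inside ∷ S)  (suc x) =
    trans (cong₂ _+_ (σ-inside S x) (σ-outside (∁ S) x)) (cong suc (σ+σ∁≡toℕ S x))
  σ+σ∁≡toℕ (outside ∷ S) (suc x) =
    trans (cong₂ _+_ (σ-outside S x) (σ-inside (∁ S) x)) (trans (+-suc _ _) (cong suc (σ+σ∁≡toℕ S x)))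

  length-filter-<?-zero : ∀ (L : List (Fin (suc n))) → length (filter (_<? zero {n}) L) ≡ 0
  length-filter-<?-zero []      = refl
  length-filter-<?-zero (y ∷ L) = length-filter-<?-zero L

  length-filter-<?-suc : ∀ (x : Fin n) (L : List (Fin n)) →
                         length (filter (_<? suc x) (map suc L)) ≡ length (filter (_<? x) L)
  length-filter-<?-suc x []      = refl
  length-filter-<?-suc x (y ∷ L) with does (y <? x)
  ... | true  = cong suc (length-filter-<?-suc x L)
  ... | false = length-filter-<?-suc x L

  length-filter-<?-suc-insert-zero : ∀ (x : Fin n) (L₁ L₂ : List (Fin n)) →
    length (filter (_<? suc x) (map suc L₁ List.++ zero ∷ map suc L₂)) ≡ suc (length (filter (_<? x) (L₁ List.++ L₂)))
  length-filter-<?-suc-insert-zero x []       L₂ = cong suc (length-filter-<?-suc x L₂)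
  length-filter-<?-suc-insert-zero x (y ∷ L₁) L₂ with does (y <? x)
  ... | true  = cong suc (length-filter-<?-suc-insert-zero x L₁ L₂)
  ... | false = length-filter-<?-suc-insert-zero x L₁ L₂

  inversions-map-suc : ∀ (L : List (Fin n)) → inversions F (map suc L) ≡ inversions F L
  inversions-map-suc []      = refl
  inversions-map-suc (x ∷ L) = cong₂ _+_ (length-filter-<?-suc x L) (inversions-map-suc L)

  inversions-insert-zero : ∀ (L₁ L₂ : List (Fin n)) →
    inversions F (map suc L₁ List.++ zero ∷ map suc L₂) ≡ length L₁ + inversions F (L₁ List.++ L₂)
  inversions-insert-zero []       L₂ = cong₂ _+_ (length-filter-<?-zero (map suc L₂)) (inversions-map-suc L₂)
  inversions-insert-zero (x ∷ L₁) L₂ =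
    trans (cong₂ _+_ (length-filter-<?-suc-insert-zero x L₁ L₂) (inversions-insert-zero L₁ L₂))
          (cong suc (rearrange (length (filter (_<? x) (L₁ List.++ L₂))) (length L₁) (inversions F (L₁ List.++ L₂))))
    where
    rearrange : ∀ a b c → a + (b + c) ≡ b + (a + c)
    rearrange = solve-∀

  inversions-oneLine : ∀ (B : Subset n) → inversions F (oneLine F B) ≡ inversionCount B
  inversions-oneLine []            = refl
  inversions-oneLine (inside ∷ B)  = begin
    inversions F (members (inside ∷ B) List.++ nonMembers (inside ∷ B))
      ≡⟨ cong₂ (λ M N → inversions F (M List.++ N)) (members-inside B) (nonMembers-inside B) ⟩
    inversions F ((zero ∷ map suc (members B)) List.++ map suc (nonMembers B))
      ≡⟨ cong₂ _+_ (length-filter-<?-zero (map Fin.suc (members B) List.++ map Fin.suc (nonMembers B)))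
                   (trans (cong (inversions F) (sym (List.map-++ Fin.suc (members B) (nonMembers B))))
                          (inversions-map-suc (oneLine F B))) ⟩
    inversions F (oneLine F B)
      ≡⟨ inversions-oneLine B ⟩
    inversionCount B ∎
    where open ≡-Reasoning
  inversions-oneLine (outside ∷ B) = begin
    inversions F (members (outside ∷ B) List.++ nonMembers (outside ∷ B))
      ≡⟨ cong₂ (λ M N → inversions F (M List.++ N)) (members-outside B) (nonMembers-outside B) ⟩
    inversions F (map suc (members B) List.++ zero ∷ map suc (nonMembers B))
      ≡⟨ inversions-insert-zero (members B) (nonMembers B) ⟩
    length (members B) + inversions F (oneLine F B)
      ≡⟨ cong₂ _+_ (length-members B) (inversions-oneLine B) ⟩
    ∣ B ∣ + inversionCount B ∎
    where open ≡-Reasoning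

  sign≡sgn-inversionCount : ∀ (B : Subset n) → sign F B ≡ sgn F (inversionCount B)
  sign≡sgn-inversionCount B = cong (sgn F) (inversions-oneLine B)

  sign-∪⁅⁆ : ∀ {y : Fin n} {X} → y ∉ X → sign F (X ∪ ⁅ y ⁆) ≡ sgn F (toℕ y + ∣ X ∣) ⊗ sign F X
  sign-∪⁅⁆ {y = y} {X} y∉X = begin
    sign F (X ∪ ⁅ y ⁆)
      ≡⟨ sign≡sgn-inversionCount (X ∪ ⁅ y ⁆) ⟩
    sgn F (inversionCount (X ∪ ⁅ y ⁆))
      ≡⟨ sgn-even-sum (inversionCount (X ∪ ⁅ y ⁆)) ((toℕ y + ∣ X ∣) + inversionCount X)
                      (inversionCount X + toℕ y) even ⟩
    sgn F ((toℕ y + ∣ X ∣) + inversionCount X)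
      ≡⟨ sgn-+ (toℕ y + ∣ X ∣) _ ⟩
    sgn F (toℕ y + ∣ X ∣) ⊗ sgn F (inversionCount X)
      ≡⟨ cong (sgn F (toℕ y + ∣ X ∣) ⊗_) (sym (sign≡sgn-inversionCount X)) ⟩
    sgn F (toℕ y + ∣ X ∣) ⊗ sign F X ∎
    where
    open ≡-Reasoning
    rearrange : ∀ a b c d → a + ((b + c) + d) ≡ (a + c) + (d + b)
    rearrange = solve-∀
    even : inversionCount (X ∪ ⁅ y ⁆) + ((toℕ y + ∣ X ∣) + inversionCount X)
           ≡ (inversionCount X + toℕ y) + (inversionCount X + toℕ y)
    even = trans (rearrange (inversionCount (X ∪ ⁅ y ⁆)) (toℕ y) ∣ X ∣ (inversionCount X))
                 (cong (_+ (inversionCount X + toℕ y)) (inversionCount-∪⁅⁆ y∉X))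

  sign-─⁅⁆ : ∀ {y : Fin n} {A} → y ∈ A → sign F (A - y) ≡ sgn F (toℕ y + ∣ A - y ∣) ⊗ sign F A
  sign-─⁅⁆ {y = y} {A} y∈A = begin
    sign F (A - y)                ≡⟨ sym (⊗-identityˡ (sign F (A - y))) ⟩
    just e ⊗ sign F (A - y)       ≡⟨ cong (_⊗ sign F (A - y)) (sym (sgn-square (toℕ y + ∣ A - y ∣))) ⟩
    (s ⊗ s) ⊗ sign F (A - y)      ≡⟨ ⊗-assoc s s (sign F (A - y)) ⟩
    s ⊗ s ⊗ sign F (A - y)        ≡⟨ cong (s ⊗_) (sym (sign-∪⁅⁆ (x∉p-x A))) ⟩
    s ⊗ sign F ((A - y) ∪ ⁅ y ⁆)  ≡⟨ cong (λ B → s ⊗ sign F B) (x∈p⇒p-x∪⁅x⁆≡p y∈A) ⟩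
    s ⊗ sign F A                  ∎
    where
    open ≡-Reasoning
    s = sgn F (toℕ y + ∣ A - y ∣)

  sign-exchange : ∀ {U : Subset n} {i j} → i ∈ U → j ∉ U →
                  sign F ((U - i) ∪ ⁅ j ⁆) ≡ sgn F (toℕ i + toℕ j) ⊗ sign F U
  sign-exchange {U = U} {i} {j} i∈U j∉U = begin
    sign F (X ∪ ⁅ j ⁆)                            ≡⟨ sign-∪⁅⁆ (j∉U ∘ p─q⊆p U ⁅ i ⁆) ⟩
    sgn F (toℕ j + ∣ X ∣) ⊗ sign F X              ≡⟨ cong (_⊗ sign F X) parity ⟩
    sgn F (ij + (toℕ i + ∣ X ∣)) ⊗ sign F X       ≡⟨ cong (_⊗ sign F X) (sgn-+ ij (toℕ i + ∣ X ∣)) ⟩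
    (sgn F ij ⊗ sgn F (toℕ i + ∣ X ∣)) ⊗ sign F X ≡⟨ ⊗-assoc (sgn F ij) _ (sign F X) ⟩
    sgn F ij ⊗ sgn F (toℕ i + ∣ X ∣) ⊗ sign F X   ≡⟨ cong (sgn F ij ⊗_) (sym (sign-∪⁅⁆ (x∉p-x U))) ⟩
    sgn F ij ⊗ sign F (X ∪ ⁅ i ⁆)                 ≡⟨ cong (λ B → sgn F ij ⊗ sign F B) (x∈p⇒p-x∪⁅x⁆≡p i∈U) ⟩
    sgn F ij ⊗ sign F U                           ∎
    where
    open ≡-Reasoning
    X  = U - i
    ij = toℕ i + toℕ j
    even : ∀ a b x → (b + x) + ((a + b) + (a + x)) ≡ ((a + b) + x) + ((a + b) + x)
    even = solve-∀
    parity : sgn F (toℕ j + ∣ X ∣) ≡ sgn F (ij + (toℕ i + ∣ X ∣))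
    parity = sgn-even-sum (toℕ j + ∣ X ∣) (ij + (toℕ i + ∣ X ∣)) (ij + ∣ X ∣) (even (toℕ i) (toℕ j) ∣ X ∣)

  -- Grassmann–Plücker sums

  formalSum : (Fin m → El F) → List G
  formalSum t = catMaybes (List.tabulate t)

  formalSum-cong : ∀ {t u : Fin m → El F} → (∀ x → t x ≡ u x) → formalSum t ≡ formalSum u
  formalSum-cong t≗u = cong catMaybes (List.tabulate-cong t≗u)

  formalSum-++ : ∀ (t : Fin (m + k) → El F) →
                 formalSum t ≡ formalSum (t ∘ (_↑ˡ k)) List.++ formalSum (t ∘ (m ↑ʳ_))
  formalSum-++ {m} {k} t = trans (cong catMaybes (tabulate-++ {m} t))
                                 (List.catMaybes-++ (List.tabulate (t ∘ (_↑ˡ k))) (List.tabulate (t ∘ (m ↑ʳ_))))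

  formalSum-nothing : ∀ (t : Fin m → El F) → (∀ x → t x ≡ nothing) → formalSum t ≡ []
  formalSum-nothing {zero}  t _ = refl
  formalSum-nothing {suc m} t t≡nothing rewrite t≡nothing zero = formalSum-nothing (t ∘ suc) (t≡nothing ∘ suc)

  formalSum-scale : ∀ g (t : Fin m → El F) → formalSum (λ x → just g ⊗ t x) ≡ map (g ·_) (formalSum t)
  formalSum-scale {zero}  g t = refl
  formalSum-scale {suc m} g t with t zero
  ... | just y  = cong (g · y ∷_) (formalSum-scale g (t ∘ suc))
  ... | nothing = formalSum-scale g (t ∘ suc)

  N-formalSum-scale : ∀ c {t u : Fin m → El F} → (∀ x → t x ≡ c ⊗ u x) → N (formalSum u) → N (formalSum t)
  N-formalSum-scale nothing  {t}     t≡0 _  = subst N (sym (formalSum-nothing t t≡0)) N-zero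
  N-formalSum-scale (just g) {t} {u} t≡gu Nu =
    subst N (sym (trans (formalSum-cong t≡gu) (formalSum-scale g u))) (N-scale g _ Nu)

  N-formalSum-halves : ∀ (t : Fin (m + k) → El F) →
                       (formalSum (t ∘ (m ↑ʳ_)) ≡ [] × N (formalSum (t ∘ (_↑ˡ k))))
                       ⊎ (formalSum (t ∘ (_↑ˡ k)) ≡ [] × N (formalSum (t ∘ (m ↑ʳ_)))) →
                       N (formalSum t)
  N-formalSum-halves {m} {k} t (inj₁ (right≡[] , N-left)) =
    subst N (sym (trans (formalSum-++ {m} t) (trans (cong (formalSum (t ∘ (_↑ˡ k)) List.++_) right≡[])
                                                    (List.++-identityʳ (formalSum (t ∘ (_↑ˡ k)))))))
            N-left
  N-formalSum-halves {m} {k} t (inj₂ (left≡[] , N-right)) =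
    subst N (sym (trans (formalSum-++ {m} t) (cong (List._++ formalSum (t ∘ (m ↑ʳ_))) left≡[]))) N-right

  gpTerm : (Subset m → El F) → (Subset m → El F) → Subset m → Subset m → Fin m → El F
  gpTerm f g S T x = if lookup S x ∧ not (lookup T x)
                     then sgn F (σ F S x + σ F T x) ⊗ f (S - x) ⊗ g (T ∪ ⁅ x ⁆)
                     else nothing

  gpSum≡formalSum : ∀ f (S T : Subset m) → gpSum F f S T ≡ formalSum (gpTerm f f S T)
  gpSum≡formalSum f S T = cong catMaybes (List.map-tabulate id (gpTerm f f S T))

  gpTerm-scale : ∀ c {f g f′ g′} {S T : Subset m} →
                 (∀ {x} → x ∈ S → x ∉ T → f (S - x) ⊗ g (T ∪ ⁅ x ⁆) ≡ c ⊗ f′ (S - x) ⊗ g′ (T ∪ ⁅ x ⁆)) →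
                 ∀ x → gpTerm f g S T x ≡ c ⊗ gpTerm f′ g′ S T x
  gpTerm-scale c {f} {g} {f′} {g′} {S} {T} scaled x with lookup S x in S[x] | lookup T x in T[x]
  ... | false | _     = sym (⊗-zeroʳ c)
  ... | true  | true  = sym (⊗-zeroʳ c)
  ... | true  | false = begin
    s ⊗ f (S - x) ⊗ g (T ∪ ⁅ x ⁆)      ≡⟨ cong (s ⊗_) (scaled (lookup⇒[]= x S S[x]) (lookup≡false⇒∉ T[x])) ⟩
    s ⊗ c ⊗ f′ (S - x) ⊗ g′ (T ∪ ⁅ x ⁆) ≡⟨ solve 3 (λ s c t → s ⊕ c ⊕ t ⊜ c ⊕ s ⊕ t) refl s c _ ⟩
    c ⊗ s ⊗ f′ (S - x) ⊗ g′ (T ∪ ⁅ x ⁆) ∎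
    where
    open ≡-Reasoning
    s = sgn F (σ F S x + σ F T x)

  gpTerm-↑ˡ : ∀ {f g : Subset (m + k) → El F} (p p′ : Subset m) (q q′ : Subset k) i →
              gpTerm f g (p ++ q) (p′ ++ q′) (i ↑ˡ k) ≡ gpTerm (λ X → f (X ++ q)) (λ X → g (X ++ q′)) p p′ i
  gpTerm-↑ˡ p p′ q q′ i
    rewrite lookup-++ˡ p q i | lookup-++ˡ p′ q′ i | σ-↑ˡ p q i | σ-↑ˡ p′ q′ i
          | ++-remove-↑ˡ p q i | ++-insert-↑ˡ p′ q′ i = refl

  gpTerm-↑ʳ : ∀ {f g : Subset (m + k) → El F} (p p′ : Subset m) (q q′ : Subset k) j →
              gpTerm f g (p ++ q) (p′ ++ q′) (m ↑ʳ j)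
              ≡ sgn F (∣ p ∣ + ∣ p′ ∣) ⊗ gpTerm (λ Y → f (p ++ Y)) (λ Y → g (p′ ++ Y)) q q′ j
  gpTerm-↑ʳ {m} {f = f} {g} p p′ q q′ j
    rewrite lookup-++ʳ p q j | lookup-++ʳ p′ q′ j | σ-↑ʳ p q j | σ-↑ʳ p′ q′ j
          | ++-remove-↑ʳ p q j | ++-insert-↑ʳ p′ q′ j
    with lookup q j ∧ not (lookup q′ j)
  ... | false = refl
  ... | true  = begin
    sgn F ((∣ p ∣ + σ F q j) + (∣ p′ ∣ + σ F q′ j)) ⊗ t
      ≡⟨ cong (λ i → sgn F i ⊗ t) (interchange (∣ p ∣) (σ F q j) (∣ p′ ∣) (σ F q′ j)) ⟩
    sgn F ((∣ p ∣ + ∣ p′ ∣) + (σ F q j + σ F q′ j)) ⊗ t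
      ≡⟨ cong (_⊗ t) (sgn-+ (∣ p ∣ + ∣ p′ ∣) _) ⟩
    (sgn F (∣ p ∣ + ∣ p′ ∣) ⊗ sgn F (σ F q j + σ F q′ j)) ⊗ t
      ≡⟨ ⊗-assoc _ _ t ⟩
    sgn F (∣ p ∣ + ∣ p′ ∣) ⊗ sgn F (σ F q j + σ F q′ j) ⊗ t ∎
    where
    open ≡-Reasoning
    t = f (p ++ (q - j)) ⊗ g (p′ ++ (q′ ∪ ⁅ j ⁆))
    interchange : ∀ a b c d → (a + b) + (c + d) ≡ (a + c) + (b + d)
    interchange = solve-∀

  dual-─⁅⁆ : ∀ (ψ : Subset n → El F) {S y} → y ∈ S →
             dual F ψ (S - y) ≡ sgn F (toℕ y + ∣ ∁ S ∣) ⊗ sign F (∁ S) ⊗ ψ (∁ S ∪ ⁅ y ⁆)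
  dual-─⁅⁆ ψ {S} {y} y∈S = begin
    sign F (∁ (S - y)) ⊗ ψ (∁ (S - y))       ≡⟨ cong (λ B → sign F B ⊗ ψ B) (∁-─ S ⁅ y ⁆) ⟩
    sign F (∁ S ∪ ⁅ y ⁆) ⊗ ψ (∁ S ∪ ⁅ y ⁆)   ≡⟨ cong (_⊗ ψ (∁ S ∪ ⁅ y ⁆)) (sign-∪⁅⁆ (x∈p⇒x∉∁p y∈S)) ⟩
    (sgn F (toℕ y + ∣ ∁ S ∣) ⊗ sign F (∁ S)) ⊗ ψ (∁ S ∪ ⁅ y ⁆)
                                             ≡⟨ ⊗-assoc _ (sign F (∁ S)) (ψ (∁ S ∪ ⁅ y ⁆)) ⟩
    sgn F (toℕ y + ∣ ∁ S ∣) ⊗ sign F (∁ S) ⊗ ψ (∁ S ∪ ⁅ y ⁆) ∎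
    where open ≡-Reasoning

  dual-∪⁅⁆ : ∀ (ψ : Subset n → El F) {T y} → y ∉ T →
             dual F ψ (T ∪ ⁅ y ⁆) ≡ sgn F (toℕ y + ∣ ∁ T - y ∣) ⊗ sign F (∁ T) ⊗ ψ (∁ T - y)
  dual-∪⁅⁆ ψ {T} {y} y∉T = begin
    sign F (∁ (T ∪ ⁅ y ⁆)) ⊗ ψ (∁ (T ∪ ⁅ y ⁆)) ≡⟨ cong (λ B → sign F B ⊗ ψ B) (∁-∪ T ⁅ y ⁆) ⟩
    sign F (∁ T - y) ⊗ ψ (∁ T - y)             ≡⟨ cong (_⊗ ψ (∁ T - y)) (sign-─⁅⁆ (x∉p⇒x∈∁p y∉T)) ⟩
    (sgn F (toℕ y + ∣ ∁ T - y ∣) ⊗ sign F (∁ T)) ⊗ ψ (∁ T - y)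
                                               ≡⟨ ⊗-assoc _ (sign F (∁ T)) (ψ (∁ T - y)) ⟩
    sgn F (toℕ y + ∣ ∁ T - y ∣) ⊗ sign F (∁ T) ⊗ ψ (∁ T - y) ∎
    where open ≡-Reasoning

  dual-gpTerm-sign : ∀ (S T : Subset n) y r →
                     sgn F (σ F S y + σ F T y) ⊗ sgn F (toℕ y + ∣ ∁ S ∣) ⊗ sgn F (toℕ y + r)
                     ≡ sgn F (∣ ∁ S ∣ + r) ⊗ sgn F (σ F (∁ T) y + σ F (∁ S) y)
  dual-gpTerm-sign S T y r = begin
    sgn F (σ F S y + σ F T y) ⊗ sgn F (toℕ y + b) ⊗ sgn F (toℕ y + r)
      ≡⟨ cong (sgn F (σ F S y + σ F T y) ⊗_) (sym (sgn-+ (toℕ y + b) (toℕ y + r))) ⟩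
    sgn F (σ F S y + σ F T y) ⊗ sgn F ((toℕ y + b) + (toℕ y + r))
      ≡⟨ sym (sgn-+ (σ F S y + σ F T y) _) ⟩
    sgn F ((σ F S y + σ F T y) + ((toℕ y + b) + (toℕ y + r)))
      ≡⟨ sgn-even-sum ((σ F S y + σ F T y) + ((toℕ y + b) + (toℕ y + r))) ((b + r) + (σ F (∁ T) y + σ F (∁ S) y))
                      (toℕ y + toℕ y + (b + r)) even ⟩
    sgn F ((b + r) + (σ F (∁ T) y + σ F (∁ S) y))
      ≡⟨ sgn-+ (b + r) _ ⟩
    sgn F (b + r) ⊗ sgn F (σ F (∁ T) y + σ F (∁ S) y) ∎
    where
    open ≡-Reasoning
    b = ∣ ∁ S ∣
    regroup : ∀ s t a c y u r → ((s + t) + ((y + u) + (y + r))) + ((u + r) + (a + c))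
                                ≡ ((s + c) + (t + a)) + ((y + y) + ((u + r) + (u + r)))
    regroup = solve-∀
    double : ∀ y u r → (y + y) + ((y + y) + ((u + r) + (u + r))) ≡ (y + y + (u + r)) + (y + y + (u + r))
    double = solve-∀
    Z = (toℕ y + toℕ y) + ((b + r) + (b + r))
    even : ((σ F S y + σ F T y) + ((toℕ y + b) + (toℕ y + r))) + ((b + r) + (σ F (∁ T) y + σ F (∁ S) y))
           ≡ (toℕ y + toℕ y + (b + r)) + (toℕ y + toℕ y + (b + r))
    even = begin
      _                                                         ≡⟨ regroup (σ F S y) (σ F T y) (σ F (∁ T) y)
                                                                           (σ F (∁ S) y) (toℕ y) b r ⟩
      ((σ F S y + σ F (∁ S) y) + (σ F T y + σ F (∁ T) y)) + Z  ≡⟨ cong₂ (λ p q → (p + q) + Z) (σ+σ∁≡toℕ S y)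
                                                                                                  (σ+σ∁≡toℕ T y) ⟩
      (toℕ y + toℕ y) + Z                                       ≡⟨ double (toℕ y) b r ⟩
      _                                                         ∎

  dual-gpTerm : ∀ {r} (ψ : Subset n → El F) (S T : Subset n) → ∣ ∁ T ∣ ≡ suc r → ∀ y →
                gpTerm (dual F ψ) (dual F ψ) S T y
                ≡ (sgn F (∣ ∁ S ∣ + r) ⊗ sign F (∁ T) ⊗ sign F (∁ S)) ⊗ gpTerm ψ ψ (∁ T) (∁ S) y
  dual-gpTerm {r = r} ψ S T ∣∁T∣≡1+r y
    rewrite lookup-map y not T | lookup-map y not S
    with lookup S y in S[y] | lookup T y in T[y]
  ... | false | false = refl
  ... | false | true  = refl
  ... | true  | true  = refl
  ... | true  | false = begin
    sgn F (σ F S y + σ F T y) ⊗ dual F ψ (S - y) ⊗ dual F ψ (T ∪ ⁅ y ⁆)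
      ≡⟨ cong₂ (λ u v → sgn F (σ F S y + σ F T y) ⊗ u ⊗ v) (dual-─⁅⁆ ψ y∈S)
               (trans (dual-∪⁅⁆ ψ y∉T) (cong (λ k → sgn F (toℕ y + k) ⊗ sign F A ⊗ ψ (A - y)) ∣A-y∣≡r)) ⟩
    sgn F (σ F S y + σ F T y) ⊗ (sgn F (toℕ y + ∣ B ∣) ⊗ sign F B ⊗ ψ (B ∪ ⁅ y ⁆))
                              ⊗ (sgn F (toℕ y + r) ⊗ sign F A ⊗ ψ (A - y))
      ≡⟨ solve 7 (λ s u v b a x z → s ⊕ (u ⊕ b ⊕ x) ⊕ (v ⊕ a ⊕ z) ⊜ (s ⊕ u ⊕ v) ⊕ ((a ⊕ b) ⊕ (z ⊕ x)))
               refl _ _ _ (sign F B) (sign F A) (ψ (B ∪ ⁅ y ⁆)) (ψ (A - y)) ⟩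
    (sgn F (σ F S y + σ F T y) ⊗ sgn F (toℕ y + ∣ B ∣) ⊗ sgn F (toℕ y + r)) ⊗ rest
      ≡⟨ cong (_⊗ rest) (dual-gpTerm-sign S T y r) ⟩
    (sgn F (∣ B ∣ + r) ⊗ sgn F (σ F A y + σ F B y)) ⊗ rest
      ≡⟨ solve 6 (λ c s a b z x → (c ⊕ s) ⊕ ((a ⊕ b) ⊕ (z ⊕ x)) ⊜ (c ⊕ a ⊕ b) ⊕ s ⊕ z ⊕ x)
               refl _ _ (sign F A) (sign F B) (ψ (A - y)) (ψ (B ∪ ⁅ y ⁆)) ⟩
    (sgn F (∣ B ∣ + r) ⊗ sign F A ⊗ sign F B) ⊗ sgn F (σ F A y + σ F B y) ⊗ ψ (A - y) ⊗ ψ (B ∪ ⁅ y ⁆) ∎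
    where
    open ≡-Reasoning
    A = ∁ T
    B = ∁ S
    rest = (sign F A ⊗ sign F B) ⊗ (ψ (A - y) ⊗ ψ (B ∪ ⁅ y ⁆))
    y∈S = lookup⇒[]= y S S[y]
    y∉T = lookup≡false⇒∉ T[y]
    ∣A-y∣≡r : ∣ A - y ∣ ≡ r
    ∣A-y∣≡r = suc-injective (trans (x∈p⇒suc∣p-x∣≡∣p∣ (x∉p⇒x∈∁p y∉T)) ∣∁T∣≡1+r)

  -- the GP relations of ψ^⊥, whose rank is n - r, stated through complements to avoid truncated subtraction
  dual-gp : ∀ {r} {ψ : Subset n → El F} → IsGP F n r ψ → ∀ (S T : Subset n) →
            ∣ ∁ T ∣ ≡ suc r → suc ∣ ∁ S ∣ ≡ r → N (gpSum F (dual F ψ) S T)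
  dual-gp {ψ = ψ} ψ-gp S T ∣∁T∣≡1+r 1+∣∁S∣≡r =
    subst N (sym (gpSum≡formalSum (dual F ψ) S T))
      (N-formalSum-scale _ (dual-gpTerm ψ S T ∣∁T∣≡1+r)
        (subst N (gpSum≡formalSum ψ (∁ T) (∁ S)) (IsGP.gp ψ-gp (∁ T) (∁ S) ∣∁T∣≡1+r 1+∣∁S∣≡r)))

  unstarred-++ : ∀ (U V : Subset n) → unstarred F n (U ++ V) ≡ U
  unstarred-++ U V = trans (tabulate-cong (lookup-++ˡ U V)) (tabulate∘lookup U)

  starred-++ : ∀ (U V : Subset n) → starred F n (U ++ V) ≡ V
  starred-++ U V = trans (tabulate-cong (lookup-++ʳ U V)) (tabulate∘lookup V)

  unstarred++starred : ∀ n (A : Subset (n + n)) → unstarred F n A ++ starred F n A ≡ A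
  unstarred++starred n = tabulate∘lookup-++ {n}

  ∣unstarred∣+∣starred∣ : ∀ n (A : Subset (n + n)) → ∣ unstarred F n A ∣ + ∣ starred F n A ∣ ≡ ∣ A ∣
  ∣unstarred∣+∣starred∣ n A =
    trans (sym (∣p++q∣≡∣p∣+∣q∣ (unstarred F n A) (starred F n A))) (cong ∣_∣ (unstarred++starred n A))

  skew≡∣unstarred∩starred∣ : ∀ n (A : Subset (n + n)) → skew F n A ≡ ∣ unstarred F n A ∩ starred F n A ∣
  skew≡∣unstarred∩starred∣ n A = cong ∣_∣ (trans (tabulate-cong pointwise) (tabulate∘lookup (U ∩ V)))
    where
    U = unstarred F n A
    V = starred F n A
    pointwise : ∀ i → lookup A (i ↑ˡ n) ∧ lookup A (n ↑ʳ i) ≡ lookup (U ∩ V) i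
    pointwise i = sym (trans (lookup-zipWith _∧_ i U V) (cong₂ _∧_ (lookup∘tabulate _ i) (lookup∘tabulate _ i)))

  -- The function φ

  module _ {n r : ℕ} (ψ : Subset n → El F) where

    private
      φ : Subset (n + n) → El F
      φ = phi F n r ψ

    phi-++-rank : ∀ (U V : Subset n) → ∣ U ∣ ≡ r → φ (U ++ V) ≡ ψ U ⊗ dual F ψ V
    phi-++-rank U V ∣U∣≡r
      rewrite unstarred-++ U V | starred-++ U V | dec-true (∣ U ∣ ≟ r) ∣U∣≡r = refl

    phi-++-nonrank : ∀ (U V : Subset n) → ∣ U ∣ ≢ r → φ (U ++ V) ≡ nothing
    phi-++-nonrank U V ∣U∣≢r
      rewrite unstarred-++ U V | dec-false (∣ U ∣ ≟ r) ∣U∣≢r = refl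

    phi-++-⊗-vanishes : ∀ (U V U′ V′ : Subset n) → ¬ (∣ U ∣ ≡ r × ∣ U′ ∣ ≡ r) →
                        φ (U ++ V) ⊗ φ (U′ ++ V′) ≡ nothing
    phi-++-⊗-vanishes U V U′ V′ not-both with ∣ U ∣ ≟ r | ∣ U′ ∣ ≟ r
    ... | no ∣U∣≢r  | _          = cong (_⊗ φ (U′ ++ V′)) (phi-++-nonrank U V ∣U∣≢r)
    ... | yes _     | no ∣U′∣≢r  = trans (cong (φ (U ++ V) ⊗_) (phi-++-nonrank U′ V′ ∣U′∣≢r)) (⊗-zeroʳ _)
    ... | yes ∣U∣≡r | yes ∣U′∣≡r = contradiction (∣U∣≡r , ∣U′∣≡r) not-both

    module _ (U V U′ V′ : Subset n) where

      private
        t : Fin (n + n) → El F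
        t = gpTerm φ φ (U ++ V) (U′ ++ V′)

      unstarred-terms : ∀ c → (∀ {i} → i ∈ U → i ∉ U′ → φ ((U - i) ++ V) ⊗ φ ((U′ ∪ ⁅ i ⁆) ++ V′)
                                                         ≡ c ⊗ ψ (U - i) ⊗ ψ (U′ ∪ ⁅ i ⁆)) →
                        ∀ i → t (i ↑ˡ n) ≡ c ⊗ gpTerm ψ ψ U U′ i
      unstarred-terms c scaled i =
        trans (gpTerm-↑ˡ {f = φ} {φ} U U′ V V′ i)
              (gpTerm-scale c {λ X → φ (X ++ V)} {λ X → φ (X ++ V′)} {ψ} {ψ} scaled i)

      starred-terms : ∀ c → (∀ {j} → j ∈ V → j ∉ V′ → φ (U ++ (V - j)) ⊗ φ (U′ ++ (V′ ∪ ⁅ j ⁆))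
                                                       ≡ c ⊗ dual F ψ (V - j) ⊗ dual F ψ (V′ ∪ ⁅ j ⁆)) →
                      ∀ j → t (n ↑ʳ j) ≡ (sgn F (∣ U ∣ + ∣ U′ ∣) ⊗ c) ⊗ gpTerm (dual F ψ) (dual F ψ) V V′ j
      starred-terms c scaled j =
        trans (gpTerm-↑ʳ {f = φ} {φ} U U′ V V′ j)
              (trans (cong (sgn F (∣ U ∣ + ∣ U′ ∣) ⊗_)
                           (gpTerm-scale c {λ Y → φ (U ++ Y)} {λ Y → φ (U′ ++ Y)} {dual F ψ} {dual F ψ} scaled j))
                     (sym (⊗-assoc _ c _)))

      unstarred-terms-vanish : ¬ (∣ U ∣ ≡ suc r × suc ∣ U′ ∣ ≡ r) → formalSum (t ∘ (_↑ˡ n)) ≡ []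
      unstarred-terms-vanish not-both = formalSum-nothing _ (unstarred-terms nothing λ {i} i∈U i∉U′ →
        phi-++-⊗-vanishes (U - i) V (U′ ∪ ⁅ i ⁆) V′ λ (∣U-i∣≡r , ∣U′∪i∣≡r) →
          not-both ( trans (sym (x∈p⇒suc∣p-x∣≡∣p∣ i∈U)) (cong suc ∣U-i∣≡r)
                   , trans (sym (x∉p⇒∣p∪⁅x⁆∣≡suc∣p∣ i∉U′)) ∣U′∪i∣≡r))

      starred-terms-vanish : ¬ (∣ U ∣ ≡ r × ∣ U′ ∣ ≡ r) → formalSum (t ∘ (n ↑ʳ_)) ≡ []
      starred-terms-vanish not-both = formalSum-nothing _ (starred-terms nothing λ {j} _ _ →
        phi-++-⊗-vanishes U (V - j) U′ (V′ ∪ ⁅ j ⁆) not-both)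

      N-unstarred-terms : IsGP F n r ψ → ∣ U ∣ ≡ suc r → suc ∣ U′ ∣ ≡ r → N (formalSum (t ∘ (_↑ˡ n)))
      N-unstarred-terms ψ-gp ∣U∣≡1+r 1+∣U′∣≡r =
        N-formalSum-scale _ (unstarred-terms (dual F ψ V ⊗ dual F ψ V′) scaled)
          (subst N (gpSum≡formalSum ψ U U′) (IsGP.gp ψ-gp U U′ ∣U∣≡1+r 1+∣U′∣≡r))
        where
        scaled : ∀ {i} → i ∈ U → i ∉ U′ → φ ((U - i) ++ V) ⊗ φ ((U′ ∪ ⁅ i ⁆) ++ V′)
                                          ≡ (dual F ψ V ⊗ dual F ψ V′) ⊗ ψ (U - i) ⊗ ψ (U′ ∪ ⁅ i ⁆)
        scaled {i} i∈U i∉U′ =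
          trans (cong₂ _⊗_ (phi-++-rank (U - i) V (suc-injective (trans (x∈p⇒suc∣p-x∣≡∣p∣ i∈U) ∣U∣≡1+r)))
                           (phi-++-rank (U′ ∪ ⁅ i ⁆) V′ (trans (x∉p⇒∣p∪⁅x⁆∣≡suc∣p∣ i∉U′) 1+∣U′∣≡r)))
                (solve 4 (λ a b c d → (a ⊕ b) ⊕ (c ⊕ d) ⊜ (b ⊕ d) ⊕ a ⊕ c) refl _ _ _ _)

      N-starred-terms : IsGP F n r ψ → ∣ U ∣ + ∣ V ∣ ≡ suc n → suc (∣ U′ ∣ + ∣ V′ ∣) ≡ n →
                        ∣ U ∣ ≡ r → ∣ U′ ∣ ≡ r → N (formalSum (t ∘ (n ↑ʳ_)))
      N-starred-terms ψ-gp ∣U∣+∣V∣≡1+n 1+∣U′∣+∣V′∣≡n ∣U∣≡r ∣U′∣≡r =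
        N-formalSum-scale _ (starred-terms (ψ U ⊗ ψ U′) scaled)
          (subst N (gpSum≡formalSum (dual F ψ) V V′) (dual-gp ψ-gp V V′ ∣∁V′∣≡1+r 1+∣∁V∣≡r))
        where
        scaled : ∀ {j} → j ∈ V → j ∉ V′ → φ (U ++ (V - j)) ⊗ φ (U′ ++ (V′ ∪ ⁅ j ⁆))
                                          ≡ (ψ U ⊗ ψ U′) ⊗ dual F ψ (V - j) ⊗ dual F ψ (V′ ∪ ⁅ j ⁆)
        scaled {j} _ _ =
          trans (cong₂ _⊗_ (phi-++-rank U (V - j) ∣U∣≡r) (phi-++-rank U′ (V′ ∪ ⁅ j ⁆) ∣U′∣≡r))
                (solve 4 (λ a b c d → (a ⊕ b) ⊕ (c ⊕ d) ⊜ (a ⊕ c) ⊕ b ⊕ d) refl _ _ _ _)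
        ∣∁V′∣≡1+r : ∣ ∁ V′ ∣ ≡ suc r
        ∣∁V′∣≡1+r = +-cancelʳ-≡ (∣ V′ ∣) (∣ ∁ V′ ∣) (suc r)
          (trans (∣∁p∣+∣p∣≡n V′) (sym (trans (cong (λ u → suc (u + ∣ V′ ∣)) (sym ∣U′∣≡r)) 1+∣U′∣+∣V′∣≡n)))
        1+∣∁V∣≡r : suc ∣ ∁ V ∣ ≡ r
        1+∣∁V∣≡r = +-cancelʳ-≡ (∣ V ∣) (suc ∣ ∁ V ∣) r
          (trans (cong suc (∣∁p∣+∣p∣≡n V)) (sym (trans (cong (_+ ∣ V ∣) (sym ∣U∣≡r)) ∣U∣+∣V∣≡1+n)))

      phi-rgp-++ : IsGP F n r ψ → ∣ U ∣ + ∣ V ∣ ≡ suc n → suc (∣ U′ ∣ + ∣ V′ ∣) ≡ n →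
                   N (gpSum F φ (U ++ V) (U′ ++ V′))
      phi-rgp-++ ψ-gp ∣S∣≡1+n 1+∣T∣≡n =
        subst N (sym (gpSum≡formalSum φ (U ++ V) (U′ ++ V′))) (N-formalSum-halves {n} t halves)
        where
        halves : (formalSum (t ∘ (n ↑ʳ_)) ≡ [] × N (formalSum (t ∘ (_↑ˡ n))))
                 ⊎ (formalSum (t ∘ (_↑ˡ n)) ≡ [] × N (formalSum (t ∘ (n ↑ʳ_))))
        halves with (∣ U ∣ ≟ suc r ×-dec suc ∣ U′ ∣ ≟ r) | (∣ U ∣ ≟ r ×-dec ∣ U′ ∣ ≟ r)
        ... | yes (∣U∣≡1+r , 1+∣U′∣≡r) | _ =
          inj₁ ( starred-terms-vanish (λ (∣U∣≡r , _) → 1+n≢n (trans (sym ∣U∣≡1+r) ∣U∣≡r))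
               , N-unstarred-terms ψ-gp ∣U∣≡1+r 1+∣U′∣≡r)
        ... | no not-unstarred | yes (∣U∣≡r , ∣U′∣≡r) =
          inj₂ (unstarred-terms-vanish not-unstarred , N-starred-terms ψ-gp ∣S∣≡1+n 1+∣T∣≡n ∣U∣≡r ∣U′∣≡r)
        ... | no not-unstarred | no not-starred =
          inj₁ (starred-terms-vanish not-starred , subst N (sym (unstarred-terms-vanish not-unstarred)) N-zero)

    phi-rgp : IsGP F n r ψ → ∀ (S T : Subset (n + n)) → ∣ S ∣ ≡ suc n → skew F n S ≡ 1 →
              suc ∣ T ∣ ≡ n → skew F n T ≡ 0 → N (gpSum F φ S T)
    phi-rgp ψ-gp S T ∣S∣≡1+n _ 1+∣T∣≡n _ =
      subst₂ (λ S T → N (gpSum F φ S T)) (unstarred++starred n S) (unstarred++starred n T)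
        (phi-rgp-++ (unstarred F n S) (starred F n S) (unstarred F n T) (starred F n T) ψ-gp
                    (trans (∣unstarred∣+∣starred∣ n S) ∣S∣≡1+n)
                    (trans (cong suc (∣unstarred∣+∣starred∣ n T)) 1+∣T∣≡n))

    phi-sym-++ : ∀ (U V : Subset n) {i j} → ∣ U ∣ + ∣ V ∣ ≡ n → ∣ U ∩ V ∣ ≡ 1 →
                 i ∈ U → i ∈ V → j ∉ U → j ∉ V →
                 φ (U ++ V) ≡ sgn F (toℕ i + toℕ j) ⊗ φ (((U - i) ∪ ⁅ j ⁆) ++ ((V - i) ∪ ⁅ j ⁆))
    phi-sym-++ U V {i} {j} ∣U∣+∣V∣≡n ∣U∩V∣≡1 i∈U i∈V j∉U j∉V = by-rank (∣ U ∣ ≟ r)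
      where
      open ≡-Reasoning
      s  = sgn F (toℕ i + toℕ j)
      W  = (U - i) ∪ ⁅ j ⁆
      W′ = (V - i) ∪ ⁅ j ⁆
      ∣W∣≡∣U∣ : ∣ W ∣ ≡ ∣ U ∣
      ∣W∣≡∣U∣ = trans (x∉p⇒∣p∪⁅x⁆∣≡suc∣p∣ (j∉U ∘ p─q⊆p U ⁅ i ⁆)) (x∈p⇒suc∣p-x∣≡∣p∣ i∈U)
      U∩V⊆⁅i⁆ : ∀ {x} → x ∈ U → x ∈ V → x ≡ i
      U∩V⊆⁅i⁆ x∈U x∈V = ∣p∣≡1⇒x∈p⇒y∈p⇒y≡x ∣U∩V∣≡1 (x∈p∩q⁺ (i∈U , i∈V)) (x∈p∩q⁺ (x∈U , x∈V))
      W≡∁V : W ≡ ∁ V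
      W≡∁V = p-i∪⁅j⁆≡∁q ∣U∣+∣V∣≡n U∩V⊆⁅i⁆ i∈U j∉U j∉V
      ∁W′≡U : ∁ W′ ≡ U
      ∁W′≡U = trans (cong ∁ (p-i∪⁅j⁆≡∁q (trans (+-comm ∣ V ∣ ∣ U ∣) ∣U∣+∣V∣≡n) (flip U∩V⊆⁅i⁆) i∈V j∉V j∉U))
                    (∁-involutive U)
      by-rank : Dec (∣ U ∣ ≡ r) → φ (U ++ V) ≡ s ⊗ φ (W ++ W′)
      by-rank (no ∣U∣≢r)  =
        trans (phi-++-nonrank U V ∣U∣≢r) (sym (cong (s ⊗_) (phi-++-nonrank W W′ (∣U∣≢r ∘ trans (sym ∣W∣≡∣U∣)))))
      by-rank (yes ∣U∣≡r) = begin
        φ (U ++ V)                    ≡⟨ phi-++-rank U V ∣U∣≡r ⟩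
        ψ U ⊗ sign F (∁ V) ⊗ ψ (∁ V)  ≡⟨ cong (λ B → ψ U ⊗ sign F B ⊗ ψ B) (sym W≡∁V) ⟩
        ψ U ⊗ sign F W ⊗ ψ W          ≡⟨ cong (λ σ → ψ U ⊗ σ ⊗ ψ W) (sign-exchange i∈U j∉U) ⟩
        ψ U ⊗ (s ⊗ sign F U) ⊗ ψ W    ≡⟨ solve 4 (λ u s σ w → u ⊕ (s ⊕ σ) ⊕ w ⊜ s ⊕ w ⊕ σ ⊕ u) refl _ s _ _ ⟩
        s ⊗ ψ W ⊗ sign F U ⊗ ψ U      ≡⟨ cong (λ B → s ⊗ ψ W ⊗ sign F B ⊗ ψ B) (sym ∁W′≡U) ⟩
        s ⊗ ψ W ⊗ dual F ψ W′         ≡⟨ cong (s ⊗_) (sym (phi-++-rank W W′ (trans ∣W∣≡∣U∣ ∣U∣≡r))) ⟩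
        s ⊗ φ (W ++ W′)               ∎

    phi-sym : ∀ (A : Subset (n + n)) (i j : Fin n) → ∣ A ∣ ≡ n → skew F n A ≡ 1 →
              emb F n i ∈ A → star F n i ∈ A → emb F n j ∉ A → star F n j ∉ A →
              φ A ≡ sgn F (toℕ i + toℕ j)
                      ⊗ φ ((((A - emb F n i) - star F n i) ∪ ⁅ emb F n j ⁆) ∪ ⁅ star F n j ⁆)
    phi-sym A i j ∣A∣≡n skew≡1 i∈A i*∈A j∉A j*∉A =
      subst (λ X → φ X ≡ sgn F (toℕ i + toℕ j) ⊗ φ ((((X - emb F n i) - star F n i) ∪ ⁅ emb F n j ⁆) ∪ ⁅ star F n j ⁆))
            (unstarred++starred n A)
            (trans (phi-sym-++ U V (trans (∣unstarred∣+∣starred∣ n A) ∣A∣≡n)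
                                   (trans (sym (skew≡∣unstarred∩starred∣ n A)) skew≡1)
                                   (∈-++⁻ˡ i (to-++ i∈A)) (∈-++⁻ʳ U (to-++ i*∈A))
                                   (j∉A ∘ from-++ ∘ ∈-++⁺ˡ) (j*∉A ∘ from-++ ∘ ∈-++⁺ʳ U))
                   (cong (λ X → sgn F (toℕ i + toℕ j) ⊗ φ X) (sym (++-exchange U V i j))))
      where
      U = unstarred F n A
      V = starred F n A
      to-++ : ∀ {x} → x ∈ A → x ∈ U ++ V
      to-++ = subst (_ ∈_) (sym (unstarred++starred n A))
      from-++ : ∀ {x} → x ∈ U ++ V → x ∈ A
      from-++ = subst (_ ∈_) (unstarred++starred n A)

    phi-nonzero : IsGP F n r ψ → Σ (Subset (n + n)) λ A →
                  ∣ A ∣ ≡ n × (skew F n A ≡ 0 ⊎ skew F n A ≡ 1) × φ A ≢ nothing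
    phi-nonzero ψ-gp with IsGP.nonzero ψ-gp
    ... | B , ∣B∣≡r , ψB≢0 = B ++ ∁ B , ∣A∣≡n , inj₁ skew≡0 , φA≢0
      where
      ∣A∣≡n : ∣ B ++ ∁ B ∣ ≡ n
      ∣A∣≡n = trans (∣p++q∣≡∣p∣+∣q∣ B (∁ B)) (trans (+-comm ∣ B ∣ ∣ ∁ B ∣) (∣∁p∣+∣p∣≡n B))
      skew≡0 : skew F n (B ++ ∁ B) ≡ 0
      skew≡0 = trans (skew≡∣unstarred∩starred∣ n (B ++ ∁ B))
                     (trans (cong₂ (λ X Y → ∣ X ∩ Y ∣) (unstarred-++ B (∁ B)) (starred-++ B (∁ B)))
                            (trans (cong ∣_∣ (∩-inverseʳ B)) (∣⊥∣≡0 n)))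
      φA≢0 : φ (B ++ ∁ B) ≢ nothing
      φA≢0 = subst (_≢ nothing)
                   (sym (trans (phi-++-rank B (∁ B) ∣B∣≡r) (cong (λ X → ψ B ⊗ sign F X ⊗ ψ X) (∁-involutive B))))
                   (⊗-nonzero ψB≢0 (⊗-nonzero (λ ()) ψB≢0))

lemma6p12 : {a ℓ : Level} (F : Tract a ℓ) (n r : ℕ) (ψ : Subset n → El F) →
            IsGP F n r ψ → IsRGP F n (phi F n r ψ)
lemma6p12 F n r ψ ψ-gp = record
  { nonzero = phi-nonzero F ψ ψ-gp
  ; sym     = phi-sym F ψ
  ; rgp     = phi-rgp F ψ ψ-gp
  }
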